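{- Let $n\geq 1$ be an integer. Let $Q_{0}$ be a path on $3$ vertices and $a$ an endvertex of $Q_{0}$; let $Q_{1},\ldots,Q_{n}$ be pairwise disjoint paths on $7$ vertices (disjoint from $Q_0$), and for each $1\leq i\leq n$ let $b_{i}$ be the center (fourth vertex) of $Q_{i}$. Let $H_{n}$ be the graph obtained from $Q_{0}\cup Q_1\cup\cdots\cup Q_{n}$ by adding the edges $ab_{i}$ for every $1\leq i\leq n$. Then for all $X\subseteq V(H_{n})$, $c_{1}(H_{n}-X)+\frac{2}{3}c_{3}(H_{n}-X)\leq \frac{4}{3}|X|+\frac{2}{3}$.
   Context: For a graph $H$ and an integer $i\geq 1$, $c_{i}(H)$ denotes the number of connected components of $H$ having exactly $i$ vertices. -}

module Defs where

open import Data.Nat using (ℕ; suc; _+_; _*_)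
open import Data.Fin using (Fin; zero; suc; inject₁; splitAt; remQuot)
open import Data.Fin.Subset using (Subset; _∈_; _∉_)
open import Data.Product using (Σ; _×_; _,_; ∃)
open import Data.Sum using (_⊎_; inj₁; inj₂)

data WalkIn {N : ℕ} (Adj : Fin N → Fin N → Set) (C : Subset N)
     : Fin N → Fin N → Set where
  here : ∀ {u} → u ∈ C → WalkIn Adj C u u
  step : ∀ {u w v} → u ∈ C → Adj u w → WalkIn Adj C w v → WalkIn Adj C u v

-- C is (the vertex set of) a connected component of G − X:
-- a nonempty subset of V ∖ X, connected inside itself, and closed under
-- adjacency in G − X (hence maximal).
IsComponent : {N : ℕ} → (Fin N → Fin N → Set) → Subset N → Subset N → Set
IsComponent {N} Adj X C =
  ((v : Fin N) → v ∈ C → v ∉ X) ×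
  (∃ λ v → v ∈ C) ×
  ((u v : Fin N) → u ∈ C → v ∈ C → WalkIn Adj C u v) ×
  ((u v : Fin N) → u ∈ C → Adj u v → v ∉ X → v ∈ C)

-- Structured vertices: inj₁ k  = k-th vertex of Q₀ (path 0-1-2, a = 0);
--                      inj₂ (i , j) = j-th vertex of Q_{i+1} (path 0-1-…-6,
--                      centre b_{i+1} = 3).

HVertex : ℕ → Set
HVertex n = Fin 3 ⊎ (Fin n × Fin 7)

data HEdge (n : ℕ) : HVertex n → HVertex n → Set where
  q0-01 : HEdge n (inj₁ zero) (inj₁ (suc zero))
  q0-12 : HEdge n (inj₁ (suc zero)) (inj₁ (suc (suc zero)))
  qi    : (i : Fin n) (j : Fin 6) →
          HEdge n (inj₂ (i , inject₁ j)) (inj₂ (i , suc j))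
  hub   : (i : Fin n) →
          HEdge n (inj₁ zero) (inj₂ (i , suc (suc (suc zero))))

HAdj' : (n : ℕ) → HVertex n → HVertex n → Set
HAdj' n x y = HEdge n x y ⊎ HEdge n y x

HN : ℕ → ℕ
HN n = 3 + n * 7

decode : (n : ℕ) → Fin (HN n) → HVertex n
decode n v with splitAt 3 v
... | inj₁ k = inj₁ k
... | inj₂ w = inj₂ (remQuot 7 w)

HAdj : (n : ℕ) → Fin (HN n) → Fin (HN n) → Set
HAdj n u v = HAdj' n (decode n u) (decode n v)

-- Discharging. Give weight 3 to every isolated vertex of H_n − X and weight 2 to one vertex of
-- every component with three vertices: the hub a if it lies in the component, and otherwise the
-- middle vertex of the component, which is then a subpath of some Q_i. Both kinds of vertex are
-- recognised from the membership in X of the vertices at distance at most 2, so 3 c₁ + 2 c₃ is at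
-- most a sum of local weights. Grouped along Q₀ and along each Q_i, an exhaustive check shows that
-- Q₀ carries weight at most 4 |X ∩ Q₀| + 2 and every Q_i at most 4 |X ∩ Q_i|.

module Submission where

open import Defs
open import Data.Bool using (Bool; true; false; T; not; _∧_)
open import Data.Bool.Properties using (T-∧; ∧-zeroʳ)
open import Data.Fin
  using (Fin; zero; suc; _≟_; _↑ˡ_; _↑ʳ_; combine; splitAt; join; inject₁; toℕ)
open import Data.Fin.Patterns using (0F; 1F; 2F; 3F; 4F; 5F; 6F)
open import Data.Fin.Properties
  using (any?; splitAt-↑ˡ; splitAt-↑ʳ; join-splitAt; remQuot-combine; combine-remQuot; toℕ-inject₁)
open import Data.Fin.Subset using (Subset; _∈_; _∉_; ∣_∣; _-_)
open import Data.Fin.Subset.Properties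
  using (_∈?_; ⊆-antisym; x∈p⇒∣p-x∣<∣p∣; x∈p∧x≢y⇒x∈p-y; p─q⊆p; p─⊥≡p; Empty-unique; ∣⊥∣≡0)
open import Data.List using ([]; _∷_; length)
import Data.List as List
open import Data.List.Membership.Propositional using () renaming (_∈_ to _∈ₗ_; _∉_ to _∉ₗ_)
open import Data.List.Properties using (length-tabulate)
open import Data.List.Relation.Unary.All as All using (All; []; _∷_)
import Data.List.Relation.Unary.All.Properties as All
open import Data.List.Relation.Unary.AllPairs using ([]; _∷_)
open import Data.List.Relation.Unary.Any using (here; there)
open import Data.List.Relation.Unary.Unique.Propositional using (Unique)
import Data.List.Relation.Unary.Unique.Propositional.Properties as Unique
open import Data.Nat using (ℕ; zero; suc; _+_; _*_; _≤_; _<_; _≤ᵇ_; z≤n; s≤s)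
open import Data.Nat.Properties as ℕ
  using ( ≤-reflexive; ≤-trans; ≤-<-trans; <⇒≱; <-irrefl; m≤n⇒m≤1+n; ≤ᵇ⇒≤; 1+n≢n
        ; +-assoc; +-mono-≤; *-monoʳ-≤; module ≤-Reasoning)
open import Algebra.Properties.Semiring.Sum ℕ.+-*-semiring
  using (sum-syntax; sum-cong-≗; ∑-distrib-+; *-distribˡ-sum)
open import Data.Nat.Tactic.RingSolver using (solve-∀)
open import Data.Product using (∃; _×_; _,_; proj₁; proj₂)
open import Data.Sum using (_⊎_; inj₁; inj₂)
open import Data.Unit using (tt)
open import Data.Vec using (Vec; []; _∷_; lookup)
import Data.Vec as Vec
open import Data.Vec.Properties using (lookup⇒[]=; []=⇒lookup; lookup∘tabulate)
open import Function using (_∘_; Equivalence)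
open import Function.Definitions using (Injective)
open import Relation.Binary.Definitions using (Symmetric; Irreflexive)
open import Relation.Binary.PropositionalEquality
open import Relation.Nullary using (¬_; yes; no; _×-dec_; ¬?)
open import Relation.Nullary.Decidable using (decidable-stable)
open import Relation.Nullary.Negation using (contradiction)

⟦_⟧ : Bool → ℕ
⟦ true ⟧ = 1
⟦ false ⟧ = 0

∑-mono-≤ : ∀ {m} {f g : Fin m → ℕ} → (∀ i → f i ≤ g i) → ∑[ i < m ] f i ≤ ∑[ i < m ] g i
∑-mono-≤ {zero} f≤g = z≤n
∑-mono-≤ {suc m} f≤g = +-mono-≤ (f≤g zero) (∑-mono-≤ (f≤g ∘ suc))

∑-↑ : ∀ m {k} (f : Fin (m + k) → ℕ) →
  ∑[ u < m + k ] f u ≡ ∑[ i < m ] f (i ↑ˡ k) + ∑[ j < k ] f (m ↑ʳ j)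
∑-↑ zero f = refl
∑-↑ (suc m) f = trans (cong (f zero +_) (∑-↑ m (f ∘ suc))) (sym (+-assoc (f zero) _ _))

∑-combine : ∀ m {k} (f : Fin (m * k) → ℕ) →
  ∑[ u < m * k ] f u ≡ ∑[ i < m ] ∑[ j < k ] f (combine i j)
∑-combine zero f = refl
∑-combine (suc m) {k} f =
  trans (∑-↑ k f) (cong (∑[ j < k ] f (j ↑ˡ m * k) +_) (∑-combine m (f ∘ (k ↑ʳ_))))

∣p∣≡∑ : ∀ {m} (p : Subset m) → ∣ p ∣ ≡ ∑[ i < m ] ⟦ lookup p i ⟧
∣p∣≡∑ [] = refl
∣p∣≡∑ (true ∷ p) = cong suc (∣p∣≡∑ p)
∣p∣≡∑ (false ∷ p) = ∣p∣≡∑ p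

∣p∣≤1+∣p-x∣ : ∀ {m} (p : Subset m) x → ∣ p ∣ ≤ suc ∣ p - x ∣
∣p∣≤1+∣p-x∣ (true ∷ p) zero = s≤s (≤-reflexive (cong ∣_∣ (sym (p─⊥≡p p))))
∣p∣≤1+∣p-x∣ (false ∷ p) zero = m≤n⇒m≤1+n (≤-reflexive (cong ∣_∣ (sym (p─⊥≡p p))))
∣p∣≤1+∣p-x∣ (true ∷ p) (suc x) = s≤s (∣p∣≤1+∣p-x∣ p x)
∣p∣≤1+∣p-x∣ (false ∷ p) (suc x) = ∣p∣≤1+∣p-x∣ p x

x∉p-x : ∀ {m} (p : Subset m) x → x ∉ p - x
x∉p-x (b ∷ p) zero ()
x∉p-x (b ∷ p) (suc x) (Vec.there x∈) = x∉p-x p x x∈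

∉⇒lookup≡false : ∀ {m} {p : Subset m} {x} → x ∉ p → lookup p x ≡ false
∉⇒lookup≡false {p = p} {x} x∉p with lookup p x in eq
... | true = contradiction (lookup⇒[]= x p eq) x∉p
... | false = refl

lookup≡false⇒∉ : ∀ {m} {p : Subset m} {x} → lookup p x ≡ false → x ∉ p
lookup≡false⇒∉ eq x∈p with trans (sym ([]=⇒lookup x∈p)) eq
... | ()

module _ {N : ℕ} where
  open import Data.List.Membership.DecPropositional (_≟_ {N}) using () renaming (_∈?_ to _∈ₗ?_)

  length≤∣p∣ : ∀ (p : Subset N) {xs} → Unique xs → All (_∈ p) xs → length xs ≤ ∣ p ∣
  length≤∣p∣ p [] [] = z≤n
  length≤∣p∣ p {x ∷ xs} (x≢xs ∷ uniq) (x∈p ∷ xs⊆p) =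
    ≤-<-trans (length≤∣p∣ (p - x) uniq (All.zipWith xs⊆p-x (xs⊆p , x≢xs))) (x∈p⇒∣p-x∣<∣p∣ x∈p)
    where
      xs⊆p-x : ∀ {y} → y ∈ p × x ≢ y → y ∈ p - x
      xs⊆p-x (y∈p , x≢y) = x∈p∧x≢y⇒x∈p-y y∈p (x≢y ∘ sym)

  ∣p∣≤length : ∀ (p : Subset N) xs → (∀ {z} → z ∈ p → z ∈ₗ xs) → ∣ p ∣ ≤ length xs
  ∣p∣≤length p [] p⊆[] =
    ≤-reflexive (trans (cong ∣_∣ (Empty-unique λ (_ , z∈p) → ∉[] (p⊆[] z∈p))) (∣⊥∣≡0 N))
    where
      ∉[] : ∀ {z : Fin N} → z ∉ₗ []
      ∉[] ()
  ∣p∣≤length p (x ∷ xs) p⊆x∷xs = ≤-trans (∣p∣≤1+∣p-x∣ p x) (s≤s (∣p∣≤length (p - x) xs p-x⊆xs))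
    where
      p-x⊆xs : ∀ {z} → z ∈ p - x → z ∈ₗ xs
      p-x⊆xs {z} z∈p-x with p⊆x∷xs (p─q⊆p p _ z∈p-x)
      ... | here refl = contradiction z∈p-x (x∉p-x p x)
      ... | there z∈xs = z∈xs

  ∃-∈-∉ₗ : ∀ (p : Subset N) xs → length xs < ∣ p ∣ → ∃ λ z → z ∈ p × z ∉ₗ xs
  ∃-∈-∉ₗ p xs xs<p with any? (λ z → z ∈? p ×-dec ¬? (z ∈ₗ? xs))
  ... | yes witness = witness
  ... | no ¬witness = contradiction (∣p∣≤length p xs p⊆xs) (<⇒≱ xs<p)
    where
      p⊆xs : ∀ {z} → z ∈ p → z ∈ₗ xs
      p⊆xs {z} z∈p = decidable-stable (z ∈ₗ? xs) λ z∉xs → ¬witness (z , z∈p , z∉xs)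

  ∈-exhausted : ∀ (p : Subset N) {xs} → ∣ p ∣ ≡ length xs → Unique xs → All (_∈ p) xs →
    ∀ {z} → z ∈ p → z ∈ₗ xs
  ∈-exhausted p {xs} ∣p∣≡ uniq xs⊆p {z} z∈p with z ∈ₗ? xs
  ... | yes z∈xs = z∈xs
  ... | no z∉xs = contradiction
    (subst (length xs <_) ∣p∣≡ (length≤∣p∣ p (All.¬Any⇒All¬ xs z∉xs ∷ uniq) (z∈p ∷ xs⊆p)))
    (<-irrefl refl)

  injection⇒≤∑ : ∀ {k} (P : Fin N → Bool) (φ : Fin k → Fin N) → Injective _≡_ _≡_ φ →
    (∀ i → P (φ i) ≡ true) → k ≤ ∑[ u < N ] ⟦ P u ⟧
  injection⇒≤∑ {k} P φ φ-inj Pφ = begin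
    k                                  ≡⟨ length-tabulate φ ⟨
    length (List.tabulate φ)           ≤⟨ length≤∣p∣ S (Unique.tabulate⁺ φ-inj) (All.tabulate⁺ φ∈S) ⟩
    ∣ S ∣                              ≡⟨ ∣p∣≡∑ S ⟩
    ∑[ u < N ] ⟦ lookup S u ⟧          ≡⟨ sum-cong-≗ (cong ⟦_⟧ ∘ lookup∘tabulate P) ⟩
    ∑[ u < N ] ⟦ P u ⟧                 ∎
    where
      open ≤-Reasoning
      S : Subset N
      S = Vec.tabulate P
      φ∈S : ∀ i → φ i ∈ S
      φ∈S i = lookup⇒[]= (φ i) S (trans (lookup∘tabulate P (φ i)) (Pφ i))

∉ₗ-triple : ∀ {A : Set} {z x y w : A} → z ≢ x → z ≢ y → z ≢ w → z ∉ₗ x ∷ y ∷ w ∷ []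
∉ₗ-triple z≢x _ _ (here z≡x) = z≢x z≡x
∉ₗ-triple _ z≢y _ (there (here z≡y)) = z≢y z≡y
∉ₗ-triple _ _ z≢w (there (there (here z≡w))) = z≢w z≡w

module _ {N : ℕ} {Adj : Fin N → Fin N → Set} where

  walk-head : ∀ {C u v} → WalkIn Adj C u v → u ∈ C
  walk-head (here u∈C) = u∈C
  walk-head (step u∈C _ _) = u∈C

  record Centred (C : Subset N) : Set where
    field
      middle left right : Fin N
      middle∈ : middle ∈ C
      left∈ : left ∈ C
      right∈ : right ∈ C
      left≢right : left ≢ right
      middle~left : Adj middle left
      middle~right : Adj middle right
      only : ∀ {z} → z ≢ middle → z ≢ left → z ≢ right → z ∉ C

module _ {N : ℕ} {Adj : Fin N → Fin N → Set} {X : Subset N} where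

  walk-inside : ∀ {C D u v} → IsComponent Adj X D → (∀ {w} → w ∈ C → w ∉ X) →
    WalkIn Adj C u v → u ∈ D → v ∈ D
  walk-inside D-comp C∩X=∅ (here _) u∈D = u∈D
  walk-inside D-comp@(_ , _ , _ , D-closed) C∩X=∅ (step {w = w} _ u~w walk) u∈D =
    walk-inside D-comp C∩X=∅ walk (D-closed _ w u∈D u~w (C∩X=∅ (walk-head walk)))

  component-unique : ∀ {C D v} → IsComponent Adj X C → IsComponent Adj X D → v ∈ C → v ∈ D → C ≡ D
  component-unique {v = v} C-comp@(C∩X=∅ , _ , C-conn , _) D-comp@(D∩X=∅ , _ , D-conn , _) v∈C v∈D =
    ⊆-antisym (λ u∈C → walk-inside D-comp (C∩X=∅ _) (C-conn v _ v∈C u∈C) v∈D)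
              (λ u∈D → walk-inside C-comp (D∩X=∅ _) (D-conn v _ v∈D u∈D) v∈C)

  ∃-neighbour : ∀ {C v} → IsComponent Adj X C → 1 < ∣ C ∣ → v ∈ C → ∃ λ w → w ∈ C × Adj v w
  ∃-neighbour {C} {v} (_ , _ , connected , _) 1<∣C∣ v∈C with ∃-∈-∉ₗ C (v ∷ []) 1<∣C∣
  ... | u , u∈C , u∉[v] with connected v u v∈C u∈C
  ...   | here _ = contradiction (here refl) u∉[v]
  ...   | step _ v~w walk = _ , walk-head walk , v~w

  neighbour∈X : Irreflexive _≡_ Adj → ∀ {C v w} → IsComponent Adj X C → ∣ C ∣ ≡ 1 →
    v ∈ C → Adj v w → w ∈ X
  neighbour∈X irrefl {C} {v} {w} (_ , _ , _ , closed) ∣C∣≡1 v∈C v~w with w ∈? X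
  ... | yes w∈X = w∈X
  ... | no w∉X with ∈-exhausted C ∣C∣≡1 ([] ∷ []) (v∈C ∷ []) (closed v w v∈C v~w w∉X)
  ...   | here refl = contradiction v~w (irrefl refl)

  private
    centred-from : Symmetric Adj → Irreflexive _≡_ Adj → ∀ {C} → ∣ C ∣ ≡ 3 → ∀ {v u t w} →
      v ∈ C → u ∈ C → t ∈ C → w ∈ C → t ∉ₗ v ∷ u ∷ [] → Adj v u → Adj t w → Centred C
    centred-from adj-sym irrefl {C} ∣C∣≡3 {v} {u} {t} {w} v∈C u∈C t∈C w∈C t∉[v,u] v~u t~w =
      pick (exhausted w∈C)
      where
        t≢v : t ≢ v
        t≢v = t∉[v,u] ∘ here
        t≢u : t ≢ u
        t≢u = t∉[v,u] ∘ there ∘ here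
        v≢u : v ≢ u
        v≢u v≡u = irrefl v≡u v~u
        exhausted : ∀ {z} → z ∈ C → z ∈ₗ v ∷ u ∷ t ∷ []
        exhausted = ∈-exhausted C ∣C∣≡3
          ((v≢u ∷ (t≢v ∘ sym) ∷ []) ∷ ((t≢u ∘ sym) ∷ []) ∷ [] ∷ []) (v∈C ∷ u∈C ∷ t∈C ∷ [])
        pick : w ∈ₗ v ∷ u ∷ t ∷ [] → Centred C
        pick (here w≡v) = record
          { middle = v ; left = u ; right = t ; middle∈ = v∈C ; left∈ = u∈C ; right∈ = t∈C
          ; left≢right = t≢u ∘ sym ; middle~left = v~u
          ; middle~right = adj-sym (subst (Adj t) w≡v t~w)
          ; only = λ z≢v z≢u z≢t → ∉ₗ-triple z≢v z≢u z≢t ∘ exhausted }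
        pick (there (here w≡u)) = record
          { middle = u ; left = v ; right = t ; middle∈ = u∈C ; left∈ = v∈C ; right∈ = t∈C
          ; left≢right = t≢v ∘ sym ; middle~left = adj-sym v~u
          ; middle~right = adj-sym (subst (Adj t) w≡u t~w)
          ; only = λ z≢u z≢v z≢t → ∉ₗ-triple z≢v z≢u z≢t ∘ exhausted }
        pick (there (there (here w≡t))) = contradiction t~w (irrefl (sym w≡t))

  component₃-centred : Symmetric Adj → Irreflexive _≡_ Adj → ∀ {C} → IsComponent Adj X C → ∣ C ∣ ≡ 3 →
    Centred C
  component₃-centred adj-sym irrefl {C} comp@(_ , (v , v∈C) , _) ∣C∣≡3 =
    let u , u∈C , v~u = ∃-neighbour comp 1<∣C∣ v∈C
        t , t∈C , t∉[v,u] = ∃-∈-∉ₗ C (v ∷ u ∷ []) 2<∣C∣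
        w , w∈C , t~w = ∃-neighbour comp 1<∣C∣ t∈C
    in centred-from adj-sym irrefl ∣C∣≡3 v∈C u∈C t∈C w∈C t∉[v,u] v~u t~w
    where
      1<∣C∣ : 1 < ∣ C ∣
      1<∣C∣ = subst (1 <_) (sym ∣C∣≡3) (s≤s (s≤s z≤n))
      2<∣C∣ : 2 < ∣ C ∣
      2<∣C∣ = subst (2 <_) (sym ∣C∣≡3) (s≤s (s≤s (s≤s z≤n)))

  components≤∑ : ∀ {k} (P : Fin N → Bool) (Cs : Fin k → Subset N) → Injective _≡_ _≡_ Cs →
    (∀ i → IsComponent Adj X (Cs i)) → (∀ i → ∃ λ r → r ∈ Cs i × P r ≡ true) →
    k ≤ ∑[ u < N ] ⟦ P u ⟧
  components≤∑ P Cs Cs-inj Cs-comp marked =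
    injection⇒≤∑ P (proj₁ ∘ marked) rep-injective (proj₂ ∘ proj₂ ∘ marked)
    where
      rep-injective : Injective _≡_ _≡_ (proj₁ ∘ marked)
      rep-injective {i} {j} ri≡rj = Cs-inj (component-unique (Cs-comp i) (Cs-comp j)
        (proj₁ (proj₂ (marked i))) (subst (_∈ Cs j) (sym ri≡rj) (proj₁ (proj₂ (marked j)))))

∀ᵇ : ∀ k → (Vec Bool k → Bool) → Bool
∀ᵇ zero P = P []
∀ᵇ (suc k) P = ∀ᵇ k (P ∘ (true ∷_)) ∧ ∀ᵇ k (P ∘ (false ∷_))

∀ᵇ-sound : ∀ k (P : Vec Bool k → Bool) → T (∀ᵇ k P) → ∀ v → T (P v)
∀ᵇ-sound zero P holds [] = holds
∀ᵇ-sound (suc k) P holds (true ∷ v) = ∀ᵇ-sound k _ (proj₁ (Equivalence.to T-∧ holds)) v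
∀ᵇ-sound (suc k) P holds (false ∷ v) = ∀ᵇ-sound k _ (proj₂ (Equivalence.to T-∧ holds)) v

≤-by-cases : ∀ k (f g : Vec Bool k → ℕ) → T (∀ᵇ k (λ v → f v ≤ᵇ g v)) → ∀ v → f v ≤ g v
≤-by-cases k f g holds v = ≤ᵇ⇒≤ _ _ (∀ᵇ-sound k _ holds v)

pattern a = inj₁ 0F
pattern a₁ = inj₁ 1F
pattern a₂ = inj₁ 2F
pattern q i j = inj₂ (i , j)

module _ {n : ℕ} where

  encode : HVertex n → Fin (HN n)
  encode (inj₁ k) = k ↑ˡ n * 7
  encode (q i j) = 3 ↑ʳ combine i j

  decode-encode : ∀ v → decode n (encode v) ≡ v
  decode-encode (inj₁ k) rewrite splitAt-↑ˡ 3 k (n * 7) = refl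
  decode-encode (q i j) rewrite splitAt-↑ʳ 3 (n * 7) (combine i j) | remQuot-combine i j = refl

  encode-decode : ∀ u → encode (decode n u) ≡ u
  encode-decode u with splitAt 3 {n * 7} u in eq
  ... | inj₁ k = trans (cong (join 3 (n * 7)) (sym eq)) (join-splitAt 3 (n * 7) u)
  ... | inj₂ w = trans (cong (3 ↑ʳ_) (combine-remQuot {n} 7 w))
                       (trans (cong (join 3 (n * 7)) (sym eq)) (join-splitAt 3 (n * 7) u))

  decode-injective : ∀ {u v} → decode n u ≡ decode n v → u ≡ v
  decode-injective {u} {v} e = trans (sym (encode-decode u)) (trans (cong encode e) (encode-decode v))

  encode≡⇒≡decode : ∀ {t u} → encode t ≡ u → t ≡ decode n u
  encode≡⇒≡decode {t} e = trans (sym (decode-encode t)) (cong (decode n) e)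

  HAdj'⇒HAdj : ∀ {s t} → HAdj' n s t → HAdj n (encode s) (encode t)
  HAdj'⇒HAdj {s} {t} = subst₂ (HAdj' n) (sym (decode-encode s)) (sym (decode-encode t))

  HEdge-irrefl : ∀ {u v} → HEdge n u v → u ≢ v
  HEdge-irrefl (qi i j) e =
    1+n≢n (trans (sym (cong (λ { (q _ k) → toℕ k ; (inj₁ _) → 0 }) e)) (toℕ-inject₁ j))
  HEdge-irrefl q0-01 ()
  HEdge-irrefl q0-12 ()
  HEdge-irrefl (hub i) ()

  HAdj-sym : Symmetric (HAdj n)
  HAdj-sym (inj₁ e) = inj₂ e
  HAdj-sym (inj₂ e) = inj₁ e

  HAdj-irrefl : Irreflexive _≡_ (HAdj n)
  HAdj-irrefl refl (inj₁ e) = HEdge-irrefl e refl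
  HAdj-irrefl refl (inj₂ e) = HEdge-irrefl e refl

  Nbr : HVertex n → HVertex n → Set
  Nbr a t = t ≡ a₁ ⊎ ∃ λ i → t ≡ q i 3F
  Nbr a₁ t = t ≡ a ⊎ t ≡ a₂
  Nbr a₂ t = t ≡ a₁
  Nbr (q i 0F) t = t ≡ q i 1F
  Nbr (q i 1F) t = t ≡ q i 0F ⊎ t ≡ q i 2F
  Nbr (q i 2F) t = t ≡ q i 1F ⊎ t ≡ q i 3F
  Nbr (q i 3F) t = t ≡ q i 2F ⊎ t ≡ q i 4F ⊎ t ≡ a
  Nbr (q i 4F) t = t ≡ q i 3F ⊎ t ≡ q i 5F
  Nbr (q i 5F) t = t ≡ q i 4F ⊎ t ≡ q i 6F
  Nbr (q i 6F) t = t ≡ q i 5F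

  HEdge⇒Nbr : ∀ {u v} → HEdge n u v → Nbr u v
  HEdge⇒Nbr q0-01 = inj₁ refl
  HEdge⇒Nbr q0-12 = inj₂ refl
  HEdge⇒Nbr (qi i 0F) = refl
  HEdge⇒Nbr (qi i 1F) = inj₂ refl
  HEdge⇒Nbr (qi i 2F) = inj₂ refl
  HEdge⇒Nbr (qi i 3F) = inj₂ (inj₁ refl)
  HEdge⇒Nbr (qi i 4F) = inj₂ refl
  HEdge⇒Nbr (qi i 5F) = inj₂ refl
  HEdge⇒Nbr (hub i) = inj₂ (i , refl)

  HEdge⇒Nbr˘ : ∀ {u v} → HEdge n u v → Nbr v u
  HEdge⇒Nbr˘ q0-01 = inj₁ refl
  HEdge⇒Nbr˘ q0-12 = refl
  HEdge⇒Nbr˘ (qi i 0F) = inj₁ refl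
  HEdge⇒Nbr˘ (qi i 1F) = inj₁ refl
  HEdge⇒Nbr˘ (qi i 2F) = inj₁ refl
  HEdge⇒Nbr˘ (qi i 3F) = inj₁ refl
  HEdge⇒Nbr˘ (qi i 4F) = inj₁ refl
  HEdge⇒Nbr˘ (qi i 5F) = refl
  HEdge⇒Nbr˘ (hub i) = inj₂ (inj₂ refl)

  HAdj'⇒Nbr : ∀ {u v} → HAdj' n u v → Nbr u v
  HAdj'⇒Nbr (inj₁ e) = HEdge⇒Nbr e
  HAdj'⇒Nbr (inj₂ e) = HEdge⇒Nbr˘ e

∑ᴴ : ∀ {n} → (HVertex n → ℕ) → ℕ
∑ᴴ {n} h = ∑[ k < 3 ] h (inj₁ k) + ∑[ i < n ] ∑[ j < 7 ] h (q i j)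

∑-decode : ∀ {n} (h : HVertex n → ℕ) → ∑[ u < HN n ] h (decode n u) ≡ ∑ᴴ h
∑-decode {n} h = begin
  ∑[ u < 3 + n * 7 ] h (decode n u)
    ≡⟨ ∑-↑ 3 (h ∘ decode n) ⟩
  ∑[ k < 3 ] h (decode n (k ↑ˡ n * 7)) + ∑[ w < n * 7 ] h (decode n (3 ↑ʳ w))
    ≡⟨ cong₂ _+_ (sum-cong-≗ (cong h ∘ decode-encode ∘ inj₁)) (∑-combine n (h ∘ decode n ∘ (3 ↑ʳ_))) ⟩
  ∑[ k < 3 ] h (inj₁ k) + ∑[ i < n ] ∑[ j < 7 ] h (decode n (3 ↑ʳ combine i j))
    ≡⟨ cong (_ +_) (sum-cong-≗ λ i → sum-cong-≗ λ j → cong h (decode-encode (q i j))) ⟩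
  ∑[ k < 3 ] h (inj₁ k) + ∑[ i < n ] ∑[ j < 7 ] h (q i j) ∎
  where open ≡-Reasoning

-- f zero comes last so that allᶠ {1} f reduces to f zero; hub-bound relies on this.
allᶠ : ∀ {m} → (Fin m → Bool) → Bool
allᶠ {zero} f = true
allᶠ {suc m} f = allᶠ (f ∘ suc) ∧ f zero

allᶠ-true : ∀ {m} (f : Fin m → Bool) → (∀ i → f i ≡ true) → allᶠ f ≡ true
allᶠ-true {zero} f _ = refl
allᶠ-true {suc m} f all rewrite allᶠ-true (f ∘ suc) (all ∘ suc) = all zero

allᶠ-false : ∀ {m} (f : Fin m → Bool) i → f i ≡ false → allᶠ f ≡ false
allᶠ-false f zero fi≡false rewrite fi≡false = ∧-zeroʳ _
allᶠ-false f (suc i) fi≡false rewrite allᶠ-false (f ∘ suc) i fi≡false = refl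

module _ {n : ℕ} (inX : HVertex n → Bool) where

  isolated : HVertex n → Bool
  isolated a = not (inX a) ∧ inX a₁ ∧ allᶠ (λ i → inX (q i 3F))
  isolated a₁ = not (inX a₁) ∧ inX a ∧ inX a₂
  isolated a₂ = not (inX a₂) ∧ inX a₁
  isolated (q i 0F) = not (inX (q i 0F)) ∧ inX (q i 1F)
  isolated (q i 1F) = not (inX (q i 1F)) ∧ inX (q i 0F) ∧ inX (q i 2F)
  isolated (q i 2F) = not (inX (q i 2F)) ∧ inX (q i 1F) ∧ inX (q i 3F)
  isolated (q i 3F) = not (inX (q i 3F)) ∧ inX (q i 2F) ∧ inX (q i 4F) ∧ inX a
  isolated (q i 4F) = not (inX (q i 4F)) ∧ inX (q i 3F) ∧ inX (q i 5F)
  isolated (q i 5F) = not (inX (q i 5F)) ∧ inX (q i 4F) ∧ inX (q i 6F)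
  isolated (q i 6F) = not (inX (q i 6F)) ∧ inX (q i 5F)

  centre : HVertex n → Bool
  centre a = not (inX a) ∧ not (inX a₁ ∧ allᶠ (λ i → inX (q i 3F)))
  centre (q i 1F) = not (inX (q i 0F)) ∧ not (inX (q i 1F)) ∧ not (inX (q i 2F)) ∧ inX (q i 3F)
  centre (q i 2F) = not (inX (q i 1F)) ∧ not (inX (q i 2F)) ∧ not (inX (q i 3F))
                  ∧ inX (q i 0F) ∧ inX (q i 4F) ∧ inX a
  centre (q i 3F) = not (inX (q i 2F)) ∧ not (inX (q i 3F)) ∧ not (inX (q i 4F))
                  ∧ inX (q i 1F) ∧ inX (q i 5F) ∧ inX a
  centre (q i 4F) = not (inX (q i 3F)) ∧ not (inX (q i 4F)) ∧ not (inX (q i 5F))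
                  ∧ inX (q i 2F) ∧ inX (q i 6F) ∧ inX a
  centre (q i 5F) = not (inX (q i 4F)) ∧ not (inX (q i 5F)) ∧ not (inX (q i 6F)) ∧ inX (q i 3F)
  centre _ = false

  weight : HVertex n → ℕ
  weight v = 3 * ⟦ isolated v ⟧ + 2 * ⟦ centre v ⟧

-- States of H₁ given by a vector. The weights along Q₀, resp. along Q_i, of any state function
-- reduce to those of these models, so hub-bound and path-bound are instances of finite checks.
hubModel : Vec Bool 4 → HVertex 1 → Bool
hubModel v (inj₁ k) = lookup v (inject₁ k)
hubModel v (q _ _) = lookup v 3F

pathModel : Vec Bool 8 → HVertex 1 → Bool
pathModel v (inj₁ _) = lookup v 0F
pathModel v (q _ j) = lookup v (suc j)

hub-bound : ∀ {n} (inX : HVertex n → Bool) →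
  ∑[ k < 3 ] weight inX (inj₁ k) ≤ 4 * ∑[ k < 3 ] ⟦ inX (inj₁ k) ⟧ + 2
hub-bound inX = by-cases (inX a ∷ inX a₁ ∷ inX a₂ ∷ allᶠ (λ i → inX (q i 3F)) ∷ [])
  where
    by-cases : ∀ v → ∑[ k < 3 ] weight (hubModel v) (inj₁ k) ≤ 4 * ∑[ k < 3 ] ⟦ hubModel v (inj₁ k) ⟧ + 2
    by-cases = ≤-by-cases 4 _ _ tt

path-bound : ∀ {n} (inX : HVertex n → Bool) i →
  ∑[ j < 7 ] weight inX (q i j) ≤ 4 * ∑[ j < 7 ] ⟦ inX (q i j) ⟧
path-bound inX i = by-cases (inX a ∷ Data.Vec.tabulate (λ j → inX (q i j)))
  where
    by-cases : ∀ v → ∑[ j < 7 ] weight (pathModel v) (q 0F j) ≤ 4 * ∑[ j < 7 ] ⟦ pathModel v (q 0F j) ⟧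
    by-cases = ≤-by-cases 8 _ _ tt

weight-bound : ∀ {n} (inX : HVertex n → Bool) → ∑ᴴ (weight inX) ≤ 4 * ∑ᴴ (⟦_⟧ ∘ inX) + 2
weight-bound {n} inX = begin
  ∑ᴴ (weight inX)                         ≤⟨ +-mono-≤ (hub-bound inX) (∑-mono-≤ (path-bound inX)) ⟩
  (4 * onQ₀ + 2) + ∑[ i < n ] (4 * onQ i) ≡⟨ cong ((4 * onQ₀ + 2) +_) (*-distribˡ-sum 4 onQ) ⟨
  (4 * onQ₀ + 2) + 4 * ∑[ i < n ] onQ i   ≡⟨ regroup onQ₀ (∑[ i < n ] onQ i) ⟩
  4 * ∑ᴴ (⟦_⟧ ∘ inX) + 2                  ∎
  where
    open ≤-Reasoning
    onQ₀ : ℕ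
    onQ₀ = ∑[ k < 3 ] ⟦ inX (inj₁ k) ⟧
    onQ : Fin n → ℕ
    onQ i = ∑[ j < 7 ] ⟦ inX (q i j) ⟧
    regroup : ∀ x y → (4 * x + 2) + 4 * y ≡ 4 * (x + y) + 2
    regroup = solve-∀

module _ {n : ℕ} (inX : HVertex n → Bool) where

  isolated-flag : ∀ v → inX v ≡ false → (∀ {t} → HAdj' n v t → inX t ≡ true) → isolated inX v ≡ true
  isolated-flag a v∉X nbr∈X
    rewrite v∉X | nbr∈X (inj₁ q0-01) | allᶠ-true _ (λ i → nbr∈X (inj₁ (hub i))) = refl
  isolated-flag a₁ v∉X nbr∈X rewrite v∉X | nbr∈X (inj₂ q0-01) | nbr∈X (inj₁ q0-12) = refl
  isolated-flag a₂ v∉X nbr∈X rewrite v∉X | nbr∈X (inj₂ q0-12) = refl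
  isolated-flag (q i 0F) v∉X nbr∈X rewrite v∉X | nbr∈X (inj₁ (qi i 0F)) = refl
  isolated-flag (q i 1F) v∉X nbr∈X rewrite v∉X | nbr∈X (inj₂ (qi i 0F)) | nbr∈X (inj₁ (qi i 1F)) = refl
  isolated-flag (q i 2F) v∉X nbr∈X rewrite v∉X | nbr∈X (inj₂ (qi i 1F)) | nbr∈X (inj₁ (qi i 2F)) = refl
  isolated-flag (q i 3F) v∉X nbr∈X
    rewrite v∉X | nbr∈X (inj₂ (qi i 2F)) | nbr∈X (inj₁ (qi i 3F)) | nbr∈X (inj₂ (hub i)) = refl
  isolated-flag (q i 4F) v∉X nbr∈X rewrite v∉X | nbr∈X (inj₂ (qi i 3F)) | nbr∈X (inj₁ (qi i 4F)) = refl
  isolated-flag (q i 5F) v∉X nbr∈X rewrite v∉X | nbr∈X (inj₂ (qi i 4F)) | nbr∈X (inj₁ (qi i 5F)) = refl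
  isolated-flag (q i 6F) v∉X nbr∈X rewrite v∉X | nbr∈X (inj₂ (qi i 5F)) = refl

  hub-centre-flag : ∀ {t} → inX a ≡ false → Nbr a t → inX t ≡ false → centre inX a ≡ true
  hub-centre-flag a∉X (inj₁ refl) t∉X rewrite a∉X | t∉X = refl
  hub-centre-flag a∉X (inj₂ (i , refl)) t∉X
    rewrite a∉X | allᶠ-false (λ i → inX (q i 3F)) i t∉X | ∧-zeroʳ (inX a₁) = refl

data Segment {n : ℕ} : HVertex n → HVertex n → HVertex n → Set where
  seg₁ : ∀ i → Segment (q i 0F) (q i 1F) (q i 2F)
  seg₂ : ∀ i → Segment (q i 1F) (q i 2F) (q i 3F)
  seg₃ : ∀ i → Segment (q i 2F) (q i 3F) (q i 4F)
  seg₄ : ∀ i → Segment (q i 3F) (q i 4F) (q i 5F)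
  seg₅ : ∀ i → Segment (q i 4F) (q i 5F) (q i 6F)

module _ {n : ℕ} where

  nbrs⇒Segment : ∀ {c l r : HVertex n} → c ≢ a → l ≢ a → r ≢ a → l ≢ r → Nbr c l → Nbr c r →
    Segment l c r ⊎ Segment r c l
  nbrs⇒Segment {a} c≢a _ _ _ _ _ = contradiction refl c≢a
  nbrs⇒Segment {a₁} _ l≢a _ _ (inj₁ refl) _ = contradiction refl l≢a
  nbrs⇒Segment {a₁} _ _ r≢a _ _ (inj₁ refl) = contradiction refl r≢a
  nbrs⇒Segment {a₁} _ _ _ l≢r (inj₂ refl) (inj₂ refl) = contradiction refl l≢r
  nbrs⇒Segment {a₂} _ _ _ l≢r refl refl = contradiction refl l≢r
  nbrs⇒Segment {q i 0F} _ _ _ l≢r refl refl = contradiction refl l≢r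
  nbrs⇒Segment {q i 1F} _ _ _ _ (inj₁ refl) (inj₂ refl) = inj₁ (seg₁ i)
  nbrs⇒Segment {q i 1F} _ _ _ _ (inj₂ refl) (inj₁ refl) = inj₂ (seg₁ i)
  nbrs⇒Segment {q i 1F} _ _ _ l≢r (inj₁ refl) (inj₁ refl) = contradiction refl l≢r
  nbrs⇒Segment {q i 1F} _ _ _ l≢r (inj₂ refl) (inj₂ refl) = contradiction refl l≢r
  nbrs⇒Segment {q i 2F} _ _ _ _ (inj₁ refl) (inj₂ refl) = inj₁ (seg₂ i)
  nbrs⇒Segment {q i 2F} _ _ _ _ (inj₂ refl) (inj₁ refl) = inj₂ (seg₂ i)
  nbrs⇒Segment {q i 2F} _ _ _ l≢r (inj₁ refl) (inj₁ refl) = contradiction refl l≢r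
  nbrs⇒Segment {q i 2F} _ _ _ l≢r (inj₂ refl) (inj₂ refl) = contradiction refl l≢r
  nbrs⇒Segment {q i 3F} _ l≢a _ _ (inj₂ (inj₂ refl)) _ = contradiction refl l≢a
  nbrs⇒Segment {q i 3F} _ _ r≢a _ _ (inj₂ (inj₂ refl)) = contradiction refl r≢a
  nbrs⇒Segment {q i 3F} _ _ _ _ (inj₁ refl) (inj₂ (inj₁ refl)) = inj₁ (seg₃ i)
  nbrs⇒Segment {q i 3F} _ _ _ _ (inj₂ (inj₁ refl)) (inj₁ refl) = inj₂ (seg₃ i)
  nbrs⇒Segment {q i 3F} _ _ _ l≢r (inj₁ refl) (inj₁ refl) = contradiction refl l≢r
  nbrs⇒Segment {q i 3F} _ _ _ l≢r (inj₂ (inj₁ refl)) (inj₂ (inj₁ refl)) = contradiction refl l≢r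
  nbrs⇒Segment {q i 4F} _ _ _ _ (inj₁ refl) (inj₂ refl) = inj₁ (seg₄ i)
  nbrs⇒Segment {q i 4F} _ _ _ _ (inj₂ refl) (inj₁ refl) = inj₂ (seg₄ i)
  nbrs⇒Segment {q i 4F} _ _ _ l≢r (inj₁ refl) (inj₁ refl) = contradiction refl l≢r
  nbrs⇒Segment {q i 4F} _ _ _ l≢r (inj₂ refl) (inj₂ refl) = contradiction refl l≢r
  nbrs⇒Segment {q i 5F} _ _ _ _ (inj₁ refl) (inj₂ refl) = inj₁ (seg₅ i)
  nbrs⇒Segment {q i 5F} _ _ _ _ (inj₂ refl) (inj₁ refl) = inj₂ (seg₅ i)
  nbrs⇒Segment {q i 5F} _ _ _ l≢r (inj₁ refl) (inj₁ refl) = contradiction refl l≢r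
  nbrs⇒Segment {q i 5F} _ _ _ l≢r (inj₂ refl) (inj₂ refl) = contradiction refl l≢r
  nbrs⇒Segment {q i 6F} _ _ _ l≢r refl refl = contradiction refl l≢r

module _ {n : ℕ} (inX : HVertex n → Bool) (InC : HVertex n → Set)
         (InC⇒∉X : ∀ t → InC t → inX t ≡ false)
         (closed : ∀ s t → InC s → HAdj' n s t → inX t ≡ false → InC t) where

  forced : ∀ {s t} → InC s → HAdj' n s t → ¬ InC t → inX t ≡ true
  forced {s} {t} s∈C s~t t∉C with inX t in eq
  ... | true = refl
  ... | false = contradiction (closed s t s∈C s~t eq) t∉C

  Segment⇒centre : ∀ {l c r} → Segment l c r → InC l → InC c → InC r →
    (∀ t → t ≢ c → t ≢ l → t ≢ r → ¬ InC t) → centre inX c ≡ true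
  Segment⇒centre (seg₁ i) l∈C c∈C r∈C only
    rewrite InC⇒∉X _ l∈C | InC⇒∉X _ c∈C | InC⇒∉X _ r∈C
          | forced r∈C (inj₁ (qi i 2F)) (only _ (λ ()) (λ ()) (λ ())) = refl
  Segment⇒centre (seg₂ i) l∈C c∈C r∈C only
    rewrite InC⇒∉X _ l∈C | InC⇒∉X _ c∈C | InC⇒∉X _ r∈C
          | forced l∈C (inj₂ (qi i 0F)) (only _ (λ ()) (λ ()) (λ ()))
          | forced r∈C (inj₁ (qi i 3F)) (only _ (λ ()) (λ ()) (λ ()))
          | forced r∈C (inj₂ (hub i)) (only _ (λ ()) (λ ()) (λ ())) = refl
  Segment⇒centre (seg₃ i) l∈C c∈C r∈C only
    rewrite InC⇒∉X _ l∈C | InC⇒∉X _ c∈C | InC⇒∉X _ r∈C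
          | forced l∈C (inj₂ (qi i 1F)) (only _ (λ ()) (λ ()) (λ ()))
          | forced r∈C (inj₁ (qi i 4F)) (only _ (λ ()) (λ ()) (λ ()))
          | forced c∈C (inj₂ (hub i)) (only _ (λ ()) (λ ()) (λ ())) = refl
  Segment⇒centre (seg₄ i) l∈C c∈C r∈C only
    rewrite InC⇒∉X _ l∈C | InC⇒∉X _ c∈C | InC⇒∉X _ r∈C
          | forced l∈C (inj₂ (qi i 2F)) (only _ (λ ()) (λ ()) (λ ()))
          | forced r∈C (inj₁ (qi i 5F)) (only _ (λ ()) (λ ()) (λ ()))
          | forced l∈C (inj₂ (hub i)) (only _ (λ ()) (λ ()) (λ ())) = refl
  Segment⇒centre (seg₅ i) l∈C c∈C r∈C only
    rewrite InC⇒∉X _ l∈C | InC⇒∉X _ c∈C | InC⇒∉X _ r∈C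
          | forced l∈C (inj₂ (qi i 3F)) (only _ (λ ()) (λ ()) (λ ())) = refl

module Deletion {n : ℕ} (X : Subset (HN n)) where

  inX : HVertex n → Bool
  inX v = lookup X (encode v)

  isolatedAt centreAt : Fin (HN n) → Bool
  isolatedAt = isolated inX ∘ decode n
  centreAt = centre inX ∘ decode n

  inX-decode : ∀ u → inX (decode n u) ≡ lookup X u
  inX-decode u = cong (lookup X) (encode-decode u)

  weighted-count-bound :
    3 * ∑[ u < HN n ] ⟦ isolatedAt u ⟧ + 2 * ∑[ u < HN n ] ⟦ centreAt u ⟧ ≤ 4 * ∣ X ∣ + 2
  weighted-count-bound = begin
    3 * ∑[ u < HN n ] ⟦ isolatedAt u ⟧ + 2 * ∑[ u < HN n ] ⟦ centreAt u ⟧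
      ≡⟨ cong₂ _+_ (*-distribˡ-sum 3 (⟦_⟧ ∘ isolatedAt)) (*-distribˡ-sum 2 (⟦_⟧ ∘ centreAt)) ⟩
    ∑[ u < HN n ] (3 * ⟦ isolatedAt u ⟧) + ∑[ u < HN n ] (2 * ⟦ centreAt u ⟧)
      ≡⟨ ∑-distrib-+ (λ u → 3 * ⟦ isolatedAt u ⟧) (λ u → 2 * ⟦ centreAt u ⟧) ⟨
    ∑[ u < HN n ] weight inX (decode n u)      ≡⟨ ∑-decode (weight inX) ⟩
    ∑ᴴ (weight inX)                           ≤⟨ weight-bound inX ⟩
    4 * ∑ᴴ (⟦_⟧ ∘ inX) + 2                    ≡⟨ cong (λ s → 4 * s + 2) (∑-decode (⟦_⟧ ∘ inX)) ⟨
    4 * ∑[ u < HN n ] ⟦ inX (decode n u) ⟧ + 2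
      ≡⟨ cong (λ s → 4 * s + 2) (sum-cong-≗ (cong ⟦_⟧ ∘ inX-decode)) ⟩
    4 * ∑[ u < HN n ] ⟦ lookup X u ⟧ + 2       ≡⟨ cong (λ s → 4 * s + 2) (∣p∣≡∑ X) ⟨
    4 * ∣ X ∣ + 2                             ∎
    where open ≤-Reasoning

  isolated-representative : ∀ {C} → IsComponent (HAdj n) X C → ∣ C ∣ ≡ 1 →
    ∃ λ r → r ∈ C × isolatedAt r ≡ true
  isolated-representative comp@(C∩X=∅ , (v , v∈C) , _) ∣C∣≡1 =
    v , v∈C , isolated-flag inX (decode n v) (trans (inX-decode v) (∉⇒lookup≡false (C∩X=∅ v v∈C))) nbr∈X
    where
      nbr∈X : ∀ {t} → HAdj' n (decode n v) t → inX t ≡ true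
      nbr∈X {t} v~t = []=⇒lookup (neighbour∈X HAdj-irrefl comp ∣C∣≡1 v∈C
        (subst (HAdj' n (decode n v)) (sym (decode-encode t)) v~t))

  module _ {C} (comp : IsComponent (HAdj n) X C) (∣C∣≡3 : ∣ C ∣ ≡ 3) where
    private
      InC : HVertex n → Set
      InC t = encode t ∈ C

      ∈C⇒∉X : ∀ {u} → u ∈ C → lookup X u ≡ false
      ∈C⇒∉X {u} u∈C = ∉⇒lookup≡false (proj₁ comp u u∈C)

      InC⇒∉X : ∀ t → InC t → inX t ≡ false
      InC⇒∉X _ = ∈C⇒∉X

      closed : ∀ s t → InC s → HAdj' n s t → inX t ≡ false → InC t
      closed _ _ s∈C s~t t∉X = proj₂ (proj₂ (proj₂ comp)) _ _ s∈C (HAdj'⇒HAdj s~t) (lookup≡false⇒∉ t∉X)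

      InC-decode : ∀ {u} → u ∈ C → InC (decode n u)
      InC-decode {u} = subst (_∈ C) (sym (encode-decode u))

      hub-representative : InC a → centreAt (encode {n} a) ≡ true
      hub-representative a∈C =
        let w , w∈C , a~w = ∃-neighbour {Adj = HAdj n} comp
                              (subst (1 <_) (sym ∣C∣≡3) (s≤s (s≤s z≤n))) a∈C
        in subst (λ v → centre inX v ≡ true) (sym (decode-encode {n} a))
             (hub-centre-flag inX (InC⇒∉X a a∈C)
               (HAdj'⇒Nbr (subst (λ v → HAdj' n v (decode n w)) (decode-encode {n} a) a~w))
               (trans (inX-decode w) (∈C⇒∉X w∈C)))

      module _ (cn : Centred {Adj = HAdj n} C) where
        open Centred cn

        only′ : ∀ t → t ≢ decode n middle → t ≢ decode n left → t ≢ decode n right → ¬ InC t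
        only′ t t≢m t≢l t≢r =
          only (t≢m ∘ encode≡⇒≡decode {n} {t}) (t≢l ∘ encode≡⇒≡decode {n} {t})
               (t≢r ∘ encode≡⇒≡decode {n} {t})

        middle-representative : ¬ InC a → centreAt middle ≡ true
        middle-representative a∉C
          with nbrs⇒Segment (≢a middle∈) (≢a left∈) (≢a right∈) (left≢right ∘ decode-injective)
                            (HAdj'⇒Nbr middle~left) (HAdj'⇒Nbr middle~right)
          where
            ≢a : ∀ {u} → u ∈ C → decode n u ≢ a
            ≢a u∈C u≡a = a∉C (subst (_∈ C) (cong encode u≡a) (InC-decode u∈C))
        ... | inj₁ seg = Segment⇒centre inX InC InC⇒∉X closed seg
                           (InC-decode left∈) (InC-decode middle∈) (InC-decode right∈) only′
        ... | inj₂ seg = Segment⇒centre inX InC InC⇒∉X closed seg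
                           (InC-decode right∈) (InC-decode middle∈) (InC-decode left∈)
                           (λ t t≢m t≢r t≢l → only′ t t≢m t≢l t≢r)

        segment-representative : ¬ InC a → ∃ λ r → r ∈ C × centreAt r ≡ true
        segment-representative a∉C = middle , middle∈ , middle-representative a∉C

    centre-representative : ∃ λ r → r ∈ C × centreAt r ≡ true
    centre-representative with encode {n} a ∈? C
    ... | yes a∈C = encode {n} a , a∈C , hub-representative a∈C
    ... | no a∉C = segment-representative (component₃-centred {Adj = HAdj n} {X = X}
      (λ {u v} → HAdj-sym {n} {u} {v}) (λ {u v} → HAdj-irrefl {n} {u} {v}) {C} comp ∣C∣≡3) a∉C

lemma2 : (n : ℕ) → 1 ≤ n → (X : Subset (HN n)) →
    (p q : ℕ) →
    (f : Fin p → Subset (HN n)) → Injective _≡_ _≡_ f →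
    ((i : Fin p) → IsComponent (HAdj n) X (f i) × ∣ f i ∣ ≡ 1) →
    (g : Fin q → Subset (HN n)) → Injective _≡_ _≡_ g →
    ((i : Fin q) → IsComponent (HAdj n) X (g i) × ∣ g i ∣ ≡ 3) →
    3 * p + 2 * q ≤ 4 * ∣ X ∣ + 2
lemma2 n _ X c₁ c₃ f f-inj f-comp g g-inj g-comp =
  ≤-trans (+-mono-≤ (*-monoʳ-≤ 3 c₁≤) (*-monoʳ-≤ 2 c₃≤)) weighted-count-bound
  where
    open Deletion {n} X
    c₁≤ : c₁ ≤ ∑[ u < HN n ] ⟦ isolatedAt u ⟧
    c₁≤ = components≤∑ {Adj = HAdj n} isolatedAt f f-inj (proj₁ ∘ f-comp)
            (λ i → isolated-representative (proj₁ (f-comp i)) (proj₂ (f-comp i)))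
    c₃≤ : c₃ ≤ ∑[ u < HN n ] ⟦ centreAt u ⟧
    c₃≤ = components≤∑ {Adj = HAdj n} centreAt g g-inj (proj₁ ∘ g-comp)
            (λ i → centre-representative (proj₁ (g-comp i)) (proj₂ (g-comp i)))
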